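{- Let $n\ge5$ be odd, let $|\cdot|$ be the norm $|(\xi_1,\dots,\xi_n)|=\sum_i|\xi_i|$ on $\mathbb R^n$, and fix a real number $M>n/2$. Let $(\nu_2,\dots,\nu_n)\in\{\pm1\}^{n-1}$, $t\in\mathbb N$, and let $\lambda\in\mathrm{span}_{\mathbb Z}(\Phi_{D_n})$ satisfy $|\lambda-(6t,2t\nu_2,2t\nu_3,\dots,2t\nu_n)|<t/M$. Let $\underline m\in\mathbb P(\lambda)$, and assume there is a subset $I\subset\{2,\dots,n\}$ with $|I|=n-2$ such that $m(e_1+\nu_ie_i)=0$ for all $i\in I$. Then $|\underline m|\ge(n+4-\tfrac{n}{2M})t$.
   Context: $e_1,\dots,e_n$ is the standard basis of $\mathbb R^n$; $\Phi_{D_n}=\{\pm e_i\pm e_j: i<j\}$ is the type $D_n$ root system with positive roots $\Phi^+_{D_n}=\{e_i\pm e_j:1\le i<j\le n\}$. $\mathbb P$ is the set of functions $\underline m:\Phi^+_{D_n}\to\mathbb Z_{\ge0}$, $\mathbb P(\lambda)=\{\underline m:\sum_\beta m(\beta)\beta=\lambda\}$, and $|\underline m|=\sum_\beta m(\beta)$.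
   Formalization: The parameter $M>n/2$ ranges over the rationals instead of the reals. -}

module Defs where

open import Data.Nat as ℕ using (ℕ; zero; suc)
open import Data.Integer as ℤ using (ℤ; +_; ∣_∣)
open import Data.Fin using (Fin; zero; suc; _<?_; _≟_)
open import Data.Bool using (Bool; true; false; if_then_else_)
open import Relation.Nullary.Decidable using (does)
open import Relation.Binary.PropositionalEquality using (_≡_)
open import Data.Product using (∃)

sumℤ : (n : ℕ) → (Fin n → ℤ) → ℤ
sumℤ zero    f = + 0
sumℤ (suc n) f = f zero ℤ.+ sumℤ n (λ i → f (suc i))

sumℕ : (n : ℕ) → (Fin n → ℕ) → ℕ
sumℕ zero    f = 0
sumℕ (suc n) f = f zero ℕ.+ sumℕ n (λ i → f (suc i))

Vecℤ : ℕ → Set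
Vecℤ n = Fin n → ℤ

sgn : Bool → ℤ
sgn true  = + 1
sgn false = ℤ.- (+ 1)

root : {n : ℕ} → Fin n → Fin n → Bool → Vecℤ n
root i j s k =
  (if does (i ≟ k) then + 1 else + 0) ℤ.+ (if does (j ≟ k) then sgn s else + 0)

-- Positive roots of D_n are indexed by (i , j , s) with i < j.
-- A function on positive roots with values in A is represented as
-- Fin n → Fin n → Bool → A, where only the entries with i < j matter.
OnPosRoots : ℕ → Set → Set
OnPosRoots n A = Fin n → Fin n → Bool → A

sumPosℤ : (n : ℕ) → OnPosRoots n ℤ → ℤ
sumPosℤ n f = sumℤ n (λ i → sumℤ n (λ j →
  if does (i <? j) then f i j true ℤ.+ f i j false else + 0))

sumPosℕ : (n : ℕ) → OnPosRoots n ℕ → ℕ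
sumPosℕ n f = sumℕ n (λ i → sumℕ n (λ j →
  if does (i <? j) then f i j true ℕ.+ f i j false else 0))

combo : (n : ℕ) → OnPosRoots n ℤ → Vecℤ n
combo n c k = sumPosℤ n (λ i j s → c i j s ℤ.* root i j s k)

-- λ ∈ span_ℤ(Φ_{D_n})  (= span of the positive roots, since Φ = Φ⁺ ∪ -Φ⁺)
InRootLattice : (n : ℕ) → Vecℤ n → Set
InRootLattice n v = ∃ λ (c : OnPosRoots n ℤ) → ∀ k → combo n c k ≡ v k

Partition : ℕ → Set
Partition n = OnPosRoots n ℕ

InP : (n : ℕ) → Partition n → Vecℤ n → Set
InP n m v = ∀ k → combo n (λ i j s → + (m i j s)) k ≡ v k

size : (n : ℕ) → Partition n → ℕ
size n m = sumPosℕ n m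

norm1 : (n : ℕ) → Vecℤ n → ℕ
norm1 n v = sumℕ n (λ i → ∣ v i ∣)

target : (k t : ℕ) → (Fin k → Bool) → Vecℤ (suc k)
target k t ν zero    = + (6 ℕ.* t)
target k t ν (suc i) = sgn (ν i) ℤ.* + (2 ℕ.* t)

{-# OPTIONS --safe #-}
-- Pair everything with the integral functional w = 2e₁* + Σ_{i∈I} ν_i e_i*.
-- Every positive root β has ⟨w,β⟩ ≤ 2, except e₁ + ν_i e_i for i ∈ I, which pairs
-- to 3 but has multiplicity 0 in m; hence ⟨w,λ⟩ ≤ 2|m|. On the other hand
-- ⟨w,(6t,2tν)⟩ = 2(6+|I|)t = 2(n+4)t, and as |w_j| ≤ 2 the pairings of λ and of
-- (6t,2tν) differ by at most 2|λ − (6t,2tν)| < 2t/M. So (n+4)t < |m| + t/M, and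
-- t/M ≤ (n/2)·t/M since n ≥ 2.
module Submission where

module OverIntegers where

  open import Defs
  open import Data.Nat as ℕ using (ℕ; zero; suc)
  import Data.Nat.Properties as ℕ
  import Data.Nat.Tactic.RingSolver as ℕ-Solver
  open import Data.Integer as ℤ using (ℤ; +_; -_; _+_; _*_; _-_; _≤_; +≤+; -≤+)
  import Data.Integer.Properties as ℤ
  open import Data.Integer.Tactic.RingSolver using (solve-∀)
  open import Data.Fin as Fin using (Fin; zero; suc; _<?_; _≟_)
  open import Data.Fin.Subset using (Subset; _∈_; ∣_∣)
  open import Data.Vec using (lookup; []; _∷_)
  open import Data.Vec.Properties using (lookup⇒[]=)
  open import Data.Bool using (Bool; true; false; if_then_else_)
  open import Data.Product using (_×_; _,_)
  open import Data.Sum using (_⊎_; inj₁; inj₂)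
  open import Function using (_∘_; flip)
  open import Relation.Nullary.Decidable using (Dec; does; yes; no)
  open import Relation.Binary.PropositionalEquality
  open import Algebra.Properties.Semiring.Sum ℤ.+-*-semiring
    using (sum; ∑-distrib-+; ∑-comm; *-distribˡ-sum; sum-replicate-zero; sum-cong-≗)

  sumℤ≡sum : ∀ n (f : Fin n → ℤ) → sumℤ n f ≡ sum f
  sumℤ≡sum zero    f = refl
  sumℤ≡sum (suc n) f = cong (_+_ (f zero)) (sumℤ≡sum n (f ∘ suc))

  sumℤ-cong : ∀ n {f g : Fin n → ℤ} → (∀ i → f i ≡ g i) → sumℤ n f ≡ sumℤ n g
  sumℤ-cong zero    f≗g = refl
  sumℤ-cong (suc n) f≗g = cong₂ _+_ (f≗g zero) (sumℤ-cong n (f≗g ∘ suc))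

  sumℤ-mono-≤ : ∀ n {f g : Fin n → ℤ} → (∀ i → f i ≤ g i) → sumℤ n f ≤ sumℤ n g
  sumℤ-mono-≤ zero    f≤g = ℤ.≤-refl
  sumℤ-mono-≤ (suc n) f≤g = ℤ.+-mono-≤ (f≤g zero) (sumℤ-mono-≤ n (f≤g ∘ suc))

  sumℤ-zero : ∀ n → sumℤ n (λ _ → + 0) ≡ + 0
  sumℤ-zero n = trans (sumℤ≡sum n _) (sum-replicate-zero n)

  sumℤ-distrib-+ : ∀ n (f g : Fin n → ℤ) → sumℤ n (λ i → f i + g i) ≡ sumℤ n f + sumℤ n g
  sumℤ-distrib-+ n f g = trans (sumℤ≡sum n _)
    (trans (∑-distrib-+ f g) (sym (cong₂ _+_ (sumℤ≡sum n f) (sumℤ≡sum n g))))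

  *-distribˡ-sumℤ : ∀ n c (f : Fin n → ℤ) → c * sumℤ n f ≡ sumℤ n (λ i → c * f i)
  *-distribˡ-sumℤ n c f = trans (cong (c *_) (sumℤ≡sum n f))
    (trans (*-distribˡ-sum c f) (sym (sumℤ≡sum n _)))

  sumℤ-comm : ∀ m n (f : Fin m → Fin n → ℤ) →
    sumℤ m (λ i → sumℤ n (f i)) ≡ sumℤ n (λ j → sumℤ m (λ i → f i j))
  sumℤ-comm m n f = trans (sumℤ²≡sum² m n f) (trans (∑-comm f) (sym (sumℤ²≡sum² n m (flip f))))
    where
    sumℤ²≡sum² : ∀ m n (f : Fin m → Fin n → ℤ) → sumℤ m (λ i → sumℤ n (f i)) ≡ sum (λ i → sum (f i))
    sumℤ²≡sum² m n f = trans (sumℤ≡sum m _) (sum-cong-≗ (λ i → sumℤ≡sum n (f i)))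

  sumℤ-pos : ∀ n (f : Fin n → ℕ) → sumℤ n (λ i → + f i) ≡ + sumℕ n f
  sumℤ-pos zero    f = refl
  sumℤ-pos (suc n) f = trans (cong (_+_ (+ f zero)) (sumℤ-pos n (f ∘ suc))) (sym (ℤ.pos-+ (f zero) _))

  sumℤ-delta : ∀ n (f : Fin n → ℤ) j c → sumℤ n (λ k → f k * (if does (j ≟ k) then c else + 0)) ≡ f j * c
  sumℤ-delta (suc n) f zero c = begin
    f zero * c + sumℤ n (λ k → f (suc k) * + 0) ≡⟨ cong (_+_ (f zero * c)) tail≡0 ⟩
    f zero * c + + 0                            ≡⟨ ℤ.+-identityʳ _ ⟩
    f zero * c                                  ∎
    where
    open ≡-Reasoning
    tail≡0 : sumℤ n (λ k → f (suc k) * + 0) ≡ + 0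
    tail≡0 = trans (sumℤ-cong n (ℤ.*-zeroʳ ∘ f ∘ suc)) (sumℤ-zero n)
  sumℤ-delta (suc n) f (suc j) c = begin
    f zero * + 0 + rest ≡⟨ cong (_+ rest) (ℤ.*-zeroʳ (f zero)) ⟩
    + 0 + rest          ≡⟨ ℤ.+-identityˡ rest ⟩
    rest                ≡⟨ sumℤ-delta n (f ∘ suc) j c ⟩
    f (suc j) * c       ∎
    where
    open ≡-Reasoning
    rest = sumℤ n (λ k → f (suc k) * (if does (j ≟ k) then c else + 0))

  sumℤ-count : ∀ {k} (I : Subset k) x → sumℤ k (λ i → if lookup I i then + x else + 0) ≡ + (∣ I ∣ ℕ.* x)
  sumℤ-count []          x = refl
  sumℤ-count (true ∷ I)  x = trans (cong (_+_ (+ x)) (sumℤ-count I x)) (sym (ℤ.pos-+ x _))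
  sumℤ-count (false ∷ I) x = trans (ℤ.+-identityˡ _) (sumℤ-count I x)

  sumPosℤ-cong : ∀ n {f g : OnPosRoots n ℤ} → (∀ i j s → f i j s ≡ g i j s) → sumPosℤ n f ≡ sumPosℤ n g
  sumPosℤ-cong n f≗g = sumℤ-cong n λ i → sumℤ-cong n λ j →
    cong₂ (λ x y → if does (i <? j) then x + y else + 0) (f≗g i j true) (f≗g i j false)

  sumPosℤ-mono-≤ : ∀ n {f g : OnPosRoots n ℤ} → (∀ i j s → i Fin.< j → f i j s ≤ g i j s) →
    sumPosℤ n f ≤ sumPosℤ n g
  sumPosℤ-mono-≤ n {f} {g} f≤g = sumℤ-mono-≤ n λ i → sumℤ-mono-≤ n λ j → pair-≤ i j (i <? j)
    where
    pair-≤ : ∀ i j (i<?j : Dec (i Fin.< j)) → (if does i<?j then f i j true + f i j false else + 0)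
                                            ≤ (if does i<?j then g i j true + g i j false else + 0)
    pair-≤ i j (yes i<j) = ℤ.+-mono-≤ (f≤g i j true i<j) (f≤g i j false i<j)
    pair-≤ i j (no _)    = ℤ.≤-refl

  *-distribˡ-sumPosℤ : ∀ n c (f : OnPosRoots n ℤ) → c * sumPosℤ n f ≡ sumPosℤ n (λ i j s → c * f i j s)
  *-distribˡ-sumPosℤ n c f = trans (*-distribˡ-sumℤ n c _) (sumℤ-cong n λ i →
    trans (*-distribˡ-sumℤ n c _) (sumℤ-cong n λ j → pair-distrib (does (i <? j)) (f i j true) (f i j false)))
    where
    pair-distrib : ∀ b x y → c * (if b then x + y else + 0) ≡ (if b then c * x + c * y else + 0)
    pair-distrib true  x y = ℤ.*-distribˡ-+ c x y
    pair-distrib false x y = ℤ.*-zeroʳ c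

  sumℤ-sumPosℤ-comm : ∀ m n (f : Fin m → OnPosRoots n ℤ) →
    sumℤ m (λ k → sumPosℤ n (f k)) ≡ sumPosℤ n (λ i j s → sumℤ m (λ k → f k i j s))
  sumℤ-sumPosℤ-comm m n f = trans (sumℤ-comm m n _) (sumℤ-cong n λ i →
    trans (sumℤ-comm m n _) (sumℤ-cong n λ j →
      pair-comm (does (i <? j)) (λ k → f k i j true) (λ k → f k i j false)))
    where
    pair-comm : ∀ b (x y : Fin m → ℤ) →
      sumℤ m (λ k → if b then x k + y k else + 0) ≡ (if b then sumℤ m x + sumℤ m y else + 0)
    pair-comm true  x y = sumℤ-distrib-+ m x y
    pair-comm false x y = sumℤ-zero m

  sumPosℤ-pos : ∀ n (f : OnPosRoots n ℕ) → sumPosℤ n (λ i j s → + f i j s) ≡ + sumPosℕ n f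
  sumPosℤ-pos n f = trans (sumℤ-cong n λ i →
      trans (sumℤ-cong n λ j → pair-pos (does (i <? j)) (f i j true) (f i j false)) (sumℤ-pos n _))
    (sumℤ-pos n _)
    where
    pair-pos : ∀ b x y → (if b then + x + + y else + 0) ≡ + (if b then x ℕ.+ y else 0)
    pair-pos true  x y = sym (ℤ.pos-+ x y)
    pair-pos false x y = refl

  ⟨_,_⟩ : ∀ {n} → Vecℤ n → Vecℤ n → ℤ
  ⟨_,_⟩ {n} w v = sumℤ n (λ k → w k * v k)

  pairing-root : ∀ {n} (w : Vecℤ n) i j s → ⟨ w , root i j s ⟩ ≡ w i + w j * sgn s
  pairing-root {n} w i j s = begin
    ⟨ w , root i j s ⟩
      ≡⟨ sumℤ-cong n (λ k → ℤ.*-distribˡ-+ (w k) _ _) ⟩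
    sumℤ n (λ k → w k * δ i (+ 1) k + w k * δ j (sgn s) k)
      ≡⟨ sumℤ-distrib-+ n _ _ ⟩
    sumℤ n (λ k → w k * δ i (+ 1) k) + sumℤ n (λ k → w k * δ j (sgn s) k)
      ≡⟨ cong₂ _+_ (sumℤ-delta n w i (+ 1)) (sumℤ-delta n w j (sgn s)) ⟩
    w i * + 1 + w j * sgn s
      ≡⟨ cong (_+ w j * sgn s) (ℤ.*-identityʳ (w i)) ⟩
    w i + w j * sgn s ∎
    where
    open ≡-Reasoning
    δ : Fin n → ℤ → Fin n → ℤ
    δ j c k = if does (j ≟ k) then c else + 0

  pairing-combo : ∀ {n} (w : Vecℤ n) c →
    ⟨ w , combo n c ⟩ ≡ sumPosℤ n (λ i j s → c i j s * ⟨ w , root i j s ⟩)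
  pairing-combo {n} w c = begin
    sumℤ n (λ k → w k * sumPosℤ n (λ i j s → c i j s * root i j s k))
      ≡⟨ sumℤ-cong n (λ k → *-distribˡ-sumPosℤ n (w k) (λ i j s → c i j s * root i j s k)) ⟩
    sumℤ n (λ k → sumPosℤ n (λ i j s → w k * (c i j s * root i j s k)))
      ≡⟨ sumℤ-sumPosℤ-comm n n (λ k i j s → w k * (c i j s * root i j s k)) ⟩
    sumPosℤ n (λ i j s → sumℤ n (λ k → w k * (c i j s * root i j s k)))
      ≡⟨ sumPosℤ-cong n (λ i j s → trans (sumℤ-cong n (λ k → *-left-comm (w k) (c i j s) (root i j s k)))
                                         (sym (*-distribˡ-sumℤ n (c i j s) (λ k → w k * root i j s k)))) ⟩
    sumPosℤ n (λ i j s → c i j s * ⟨ w , root i j s ⟩) ∎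
    where
    open ≡-Reasoning
    *-left-comm : ∀ x y z → x * (y * z) ≡ y * (x * z)
    *-left-comm = solve-∀

  pairing-split : ∀ {n} (w u v : Vecℤ n) →
    ⟨ w , u ⟩ ≡ ⟨ w , v ⟩ + ⟨ (λ k → - w k) , (λ k → v k - u k) ⟩
  pairing-split {n} w u v = trans (sumℤ-cong n (λ k → split (w k) (u k) (v k))) (sumℤ-distrib-+ n _ _)
    where
    split : ∀ x y z → x * y ≡ x * z + (- x) * (z - y)
    split = solve-∀

  i≤+∣i∣ : ∀ i → i ≤ + ℤ.∣ i ∣
  i≤+∣i∣ (+ n)      = ℤ.≤-refl
  i≤+∣i∣ ℤ.-[1+ n ] = -≤+

  pairing-≤-norm1 : ∀ {n} (w v : Vecℤ n) a → (∀ k → ℤ.∣ w k ∣ ℕ.≤ a) →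
    ⟨ w , v ⟩ ≤ + a * + norm1 n v
  pairing-≤-norm1 {n} w v a ∣w∣≤a = begin
    ⟨ w , v ⟩                           ≤⟨ sumℤ-mono-≤ n term-≤ ⟩
    sumℤ n (λ k → + a * + ℤ.∣ v k ∣)    ≡⟨ sym (*-distribˡ-sumℤ n (+ a) (λ k → + ℤ.∣ v k ∣)) ⟩
    + a * sumℤ n (λ k → + ℤ.∣ v k ∣)    ≡⟨ cong (+ a *_) (sumℤ-pos n _) ⟩
    + a * + norm1 n v                   ∎
    where
    open ℤ.≤-Reasoning
    term-≤ : ∀ k → w k * v k ≤ + a * + ℤ.∣ v k ∣
    term-≤ k = begin
      w k * v k                       ≤⟨ i≤+∣i∣ (w k * v k) ⟩
      + ℤ.∣ w k * v k ∣               ≡⟨ cong +_ (ℤ.abs-* (w k) (v k)) ⟩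
      + (ℤ.∣ w k ∣ ℕ.* ℤ.∣ v k ∣)     ≡⟨ ℤ.pos-* ℤ.∣ w k ∣ ℤ.∣ v k ∣ ⟩
      + ℤ.∣ w k ∣ * + ℤ.∣ v k ∣       ≤⟨ ℤ.*-monoʳ-≤-nonNeg (+ ℤ.∣ v k ∣) (+≤+ (∣w∣≤a k)) ⟩
      + a * + ℤ.∣ v k ∣               ∎

  pairing-combo-≤ : ∀ {n} (w : Vecℤ n) (m : Partition n) c →
    (∀ i j s → i Fin.< j → m i j s ≡ 0 ⊎ ⟨ w , root i j s ⟩ ≤ c) →
    ⟨ w , combo n (λ i j s → + m i j s) ⟩ ≤ c * + size n m
  pairing-combo-≤ {n} w m c supported≤c = begin
    ⟨ w , combo n (λ i j s → + m i j s) ⟩                 ≡⟨ pairing-combo w (λ i j s → + m i j s) ⟩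
    sumPosℤ n (λ i j s → + m i j s * ⟨ w , root i j s ⟩)  ≤⟨ sumPosℤ-mono-≤ n term-≤ ⟩
    sumPosℤ n (λ i j s → c * + m i j s)                   ≡⟨ sym (*-distribˡ-sumPosℤ n c (λ i j s → + m i j s)) ⟩
    c * sumPosℤ n (λ i j s → + m i j s)                   ≡⟨ cong (c *_) (sumPosℤ-pos n m) ⟩
    c * + size n m                                        ∎
    where
    open ℤ.≤-Reasoning
    term-≤ : ∀ i j s → i Fin.< j → + m i j s * ⟨ w , root i j s ⟩ ≤ c * + m i j s
    term-≤ i j s i<j with supported≤c i j s i<j
    ... | inj₁ m≡0 rewrite m≡0 = ℤ.≤-reflexive (sym (ℤ.*-zeroʳ c))
    ... | inj₂ ≤c = subst (_ ≤_) (ℤ.*-comm (+ m i j s) c) (ℤ.*-monoˡ-≤-nonNeg (+ m i j s) ≤c)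

  maskedSign : Bool → Bool → ℤ
  maskedSign b c = if b then sgn c else + 0

  weight : ∀ {k} → Subset k → (Fin k → Bool) → Vecℤ (suc k)
  weight I ν zero    = + 2
  weight I ν (suc i) = maskedSign (lookup I i) (ν i)

  ∣maskedSign∣≤1 : ∀ b c → ℤ.∣ maskedSign b c ∣ ℕ.≤ 1
  ∣maskedSign∣≤1 true  true  = ℕ.≤-refl
  ∣maskedSign∣≤1 true  false = ℕ.≤-refl
  ∣maskedSign∣≤1 false c     = ℕ.z≤n

  ∣weight∣≤2 : ∀ {k} (I : Subset k) ν j → ℤ.∣ weight I ν j ∣ ℕ.≤ 2
  ∣weight∣≤2 I ν zero    = ℕ.≤-refl
  ∣weight∣≤2 I ν (suc i) = ℕ.m≤n⇒m≤1+n (∣maskedSign∣≤1 (lookup I i) (ν i))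

  maskedSign-*-sgn-≤0 : ∀ b c s → maskedSign b c * sgn s ≤ + 0 ⊎ (b ≡ true × c ≡ s)
  maskedSign-*-sgn-≤0 true  true  true  = inj₂ (refl , refl)
  maskedSign-*-sgn-≤0 true  true  false = inj₁ -≤+
  maskedSign-*-sgn-≤0 true  false true  = inj₁ -≤+
  maskedSign-*-sgn-≤0 true  false false = inj₂ (refl , refl)
  maskedSign-*-sgn-≤0 false c     s     = inj₁ ℤ.≤-refl

  maskedSign-*-sgn-self : ∀ b c x → maskedSign b c * (sgn c * x) ≡ (if b then x else + 0)
  maskedSign-*-sgn-self true  true  x = trans (ℤ.*-identityˡ _) (ℤ.*-identityˡ x)
  maskedSign-*-sgn-self true  false x = trans (sym (ℤ.*-assoc (sgn false) (sgn false) x)) (ℤ.*-identityˡ x)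
  maskedSign-*-sgn-self false c     x = refl

  ∣sgn∣≡1 : ∀ s → ℤ.∣ sgn s ∣ ≡ 1
  ∣sgn∣≡1 true  = refl
  ∣sgn∣≡1 false = refl

  x+y*sgn≤∣x∣+∣y∣ : ∀ x y s → x + y * sgn s ≤ + (ℤ.∣ x ∣ ℕ.+ ℤ.∣ y ∣)
  x+y*sgn≤∣x∣+∣y∣ x y s = begin
    x + y * sgn s                     ≤⟨ ℤ.+-mono-≤ (i≤+∣i∣ x) (i≤+∣i∣ (y * sgn s)) ⟩
    + ℤ.∣ x ∣ + + ℤ.∣ y * sgn s ∣     ≡⟨ cong (λ a → + ℤ.∣ x ∣ + + a) ∣y*sgn∣≡∣y∣ ⟩
    + ℤ.∣ x ∣ + + ℤ.∣ y ∣             ≡⟨ sym (ℤ.pos-+ ℤ.∣ x ∣ ℤ.∣ y ∣) ⟩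
    + (ℤ.∣ x ∣ ℕ.+ ℤ.∣ y ∣)           ∎
    where
    open ℤ.≤-Reasoning
    ∣y*sgn∣≡∣y∣ : ℤ.∣ y * sgn s ∣ ≡ ℤ.∣ y ∣
    ∣y*sgn∣≡∣y∣ = trans (ℤ.abs-* y (sgn s))
                        (trans (cong (ℤ.∣ y ∣ ℕ.*_) (∣sgn∣≡1 s)) (ℕ.*-identityʳ ℤ.∣ y ∣))

  weight-supported-root-≤2 : ∀ {k} (I : Subset k) ν (m : Partition (suc k)) →
    (∀ i → i ∈ I → m zero (suc i) (ν i) ≡ 0) →
    ∀ i j s → i Fin.< j → m i j s ≡ 0 ⊎ ⟨ weight I ν , root i j s ⟩ ≤ + 2
  weight-supported-root-≤2 I ν m avoid i j s i<j rewrite pairing-root (weight I ν) i j s = bound i j i<j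
    where
    bound : ∀ i j → i Fin.< j → m i j s ≡ 0 ⊎ weight I ν i + weight I ν j * sgn s ≤ + 2
    bound zero (suc j) _ with maskedSign-*-sgn-≤0 (lookup I j) (ν j) s
    ... | inj₁ ≤0              = inj₂ (ℤ.+-monoʳ-≤ (+ 2) ≤0)
    ... | inj₂ (j∈I , νj≡s)    =
      inj₁ (subst (λ s → m zero (suc j) s ≡ 0) νj≡s (avoid j (lookup⇒[]= j I j∈I)))
    bound (suc i) (suc j) _ = inj₂ (ℤ.≤-trans (x+y*sgn≤∣x∣+∣y∣ (weight I ν (suc i)) (weight I ν (suc j)) s)
      (+≤+ (ℕ.+-mono-≤ (∣maskedSign∣≤1 (lookup I i) (ν i)) (∣maskedSign∣≤1 (lookup I j) (ν j)))))

  weight-target : ∀ {k} (I : Subset k) ν t →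
    ⟨ weight I ν , target k t ν ⟩ ≡ + (2 ℕ.* ((6 ℕ.+ ∣ I ∣) ℕ.* t))
  weight-target {k} I ν t = begin
    + 2 * + (6 ℕ.* t) + sumℤ k (λ i → maskedSign (lookup I i) (ν i) * (sgn (ν i) * + (2 ℕ.* t)))
      ≡⟨ cong (_+_ (+ 2 * + (6 ℕ.* t))) (sumℤ-cong k (λ i → maskedSign-*-sgn-self (lookup I i) (ν i) _)) ⟩
    + 2 * + (6 ℕ.* t) + sumℤ k (λ i → if lookup I i then + (2 ℕ.* t) else + 0)
      ≡⟨ cong₂ _+_ (sym (ℤ.pos-* 2 (6 ℕ.* t))) (sumℤ-count I (2 ℕ.* t)) ⟩
    + (2 ℕ.* (6 ℕ.* t)) + + (∣ I ∣ ℕ.* (2 ℕ.* t))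
      ≡⟨ sym (ℤ.pos-+ (2 ℕ.* (6 ℕ.* t)) (∣ I ∣ ℕ.* (2 ℕ.* t))) ⟩
    + (2 ℕ.* (6 ℕ.* t) ℕ.+ ∣ I ∣ ℕ.* (2 ℕ.* t))
      ≡⟨ cong +_ (regroup t ∣ I ∣) ⟩
    + (2 ℕ.* ((6 ℕ.+ ∣ I ∣) ℕ.* t)) ∎
    where
    open ≡-Reasoning
    regroup : ∀ t i → 2 ℕ.* (6 ℕ.* t) ℕ.+ i ℕ.* (2 ℕ.* t) ≡ 2 ℕ.* ((6 ℕ.+ i) ℕ.* t)
    regroup = ℕ-Solver.solve-∀

  size+distance-lower-bound : ∀ {k} (I : Subset k) ν t lam (m : Partition (suc k)) → InP (suc k) m lam →
    (∀ i → i ∈ I → m zero (suc i) (ν i) ≡ 0) →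
    (6 ℕ.+ ∣ I ∣) ℕ.* t ℕ.≤ size (suc k) m ℕ.+ norm1 (suc k) (λ j → lam j - target k t ν j)
  size+distance-lower-bound {k} I ν t lam m m∈P avoid = ℕ.*-cancelˡ-≤ 2 (ℤ.drop‿+≤+ (begin
    + (2 ℕ.* ((6 ℕ.+ ∣ I ∣) ℕ.* t))        ≡⟨ sym (weight-target I ν t) ⟩
    ⟨ w , target k t ν ⟩                   ≡⟨ pairing-split w (target k t ν) lam ⟩
    ⟨ w , lam ⟩ + ⟨ -w , d ⟩                ≤⟨ ℤ.+-mono-≤ pairing-lam-≤ (pairing-≤-norm1 -w d 2 ∣-w∣≤2) ⟩
    + 2 * + S + + 2 * + N                  ≡⟨ sym (ℤ.*-distribˡ-+ (+ 2) (+ S) (+ N)) ⟩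
    + 2 * (+ S + + N)                      ≡⟨ cong (+ 2 *_) (sym (ℤ.pos-+ S N)) ⟩
    + 2 * + (S ℕ.+ N)                      ≡⟨ sym (ℤ.pos-* 2 (S ℕ.+ N)) ⟩
    + (2 ℕ.* (S ℕ.+ N))                    ∎))
    where
    open ℤ.≤-Reasoning
    w -w d : Vecℤ (suc k)
    w = weight I ν
    -w = λ j → - w j
    d = λ j → lam j - target k t ν j
    S = size (suc k) m
    N = norm1 (suc k) d
    ∣-w∣≤2 : ∀ j → ℤ.∣ - w j ∣ ℕ.≤ 2
    ∣-w∣≤2 j = subst (ℕ._≤ 2) (sym (ℤ.∣-i∣≡∣i∣ (w j))) (∣weight∣≤2 I ν j)
    pairing-lam-≤ : ⟨ w , lam ⟩ ≤ + 2 * + S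
    pairing-lam-≤ = begin
      ⟨ w , lam ⟩
        ≡⟨ sumℤ-cong (suc k) (λ j → cong (w j *_) (sym (m∈P j))) ⟩
      ⟨ w , combo (suc k) (λ i j s → + m i j s) ⟩
        ≤⟨ pairing-combo-≤ w m (+ 2) (weight-supported-root-≤2 I ν m avoid) ⟩
      + 2 * + S ∎

module OverRationals where

  open import Data.Nat as ℕ using (ℕ; suc)
  import Data.Nat.Properties as ℕ
  open import Data.Integer as ℤ using (+_; +≤+)
  import Data.Integer.Properties as ℤ
  open import Data.Integer.Tactic.RingSolver using (solve-∀)
  open import Data.Rational as ℚ using (ℚ; _/_; _÷_; _+_; _*_; _-_; -_; _≤_; _<_; 1/_; 1ℚ; toℚᵘ)
  import Data.Rational.Properties as ℚ
  open import Data.Rational.Unnormalised as ℚᵘ using (mkℚᵘ; *≤*; *≡*) renaming (_≃_ to _≃ᵘ_)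
  import Data.Rational.Unnormalised.Properties as ℚᵘ
  open import Data.Rational.Solver using (module +-*-Solver)
  open import Relation.Binary.PropositionalEquality

  ι : ℕ → ℚ
  ι n = + n / 1

  toℚᵘ-ι : ∀ n → toℚᵘ (ι n) ≃ᵘ mkℚᵘ (+ n) 0
  toℚᵘ-ι n = ℚ.toℚᵘ-fromℚᵘ (mkℚᵘ (+ n) 0)

  /-mono-≤ : ∀ {a b c d} .{{_ : ℕ.NonZero c}} .{{_ : ℕ.NonZero d}} →
    a ℕ.* d ℕ.≤ b ℕ.* c → + a / c ≤ + b / d
  /-mono-≤ {a} {b} {suc c} {suc d} ad≤bc = ℚ.toℚᵘ-cancel-≤
    (ℚᵘ.≤-respˡ-≃ (ℚᵘ.≃-sym (ℚ.toℚᵘ-fromℚᵘ (mkℚᵘ (+ a) c)))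
    (ℚᵘ.≤-respʳ-≃ (ℚᵘ.≃-sym (ℚ.toℚᵘ-fromℚᵘ (mkℚᵘ (+ b) d)))
    (*≤* (subst₂ ℤ._≤_ (ℤ.pos-* a (suc d)) (ℤ.pos-* b (suc c)) (+≤+ ad≤bc)))))

  ι-mono-≤ : ∀ {a b} → a ℕ.≤ b → ι a ≤ ι b
  ι-mono-≤ {a} {b} a≤b = /-mono-≤ {a} {b} {1} {1} (ℕ.*-monoˡ-≤ 1 a≤b)

  ι-homo-+ : ∀ a b → ι (a ℕ.+ b) ≡ ι a + ι b
  ι-homo-+ a b = ℚ.toℚᵘ-injective (ℚᵘ.≃-trans (toℚᵘ-ι (a ℕ.+ b)) (ℚᵘ.≃-trans
    (*≡* (trans (cong (ℤ._* + 1) (ℤ.pos-+ a b)) (sum-with-unit-denominators (+ a) (+ b))))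
    (ℚᵘ.≃-sym (ℚᵘ.≃-trans (ℚ.toℚᵘ-homo-+ (ι a) (ι b)) (ℚᵘ.+-cong (toℚᵘ-ι a) (toℚᵘ-ι b))))))
    where
    sum-with-unit-denominators : ∀ x y → (x ℤ.+ y) ℤ.* + 1 ≡ (x ℤ.* + 1 ℤ.+ y ℤ.* + 1) ℤ.* + 1
    sum-with-unit-denominators = solve-∀

  ι-homo-* : ∀ a b → ι (a ℕ.* b) ≡ ι a * ι b
  ι-homo-* a b = ℚ.toℚᵘ-injective (ℚᵘ.≃-trans (toℚᵘ-ι (a ℕ.* b)) (ℚᵘ.≃-trans
    (*≡* (cong (ℤ._* + 1) (ℤ.pos-* a b)))
    (ℚᵘ.≃-sym (ℚᵘ.≃-trans (ℚ.toℚᵘ-homo-* (ι a) (ι b)) (ℚᵘ.*-cong (toℚᵘ-ι a) (toℚᵘ-ι b))))))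

  slack-bound : ∀ A t S N (a M : ℚ) .{{_ : ℚ.NonZero M}} → 1ℚ ≤ a → a < M →
    ι N < ι t ÷ M → A ℕ.* t ℕ.≤ S ℕ.+ N → (ι A - a ÷ M) * ι t ≤ ι S
  slack-bound A t S N a M 1≤a a<M N<t/M At≤S+N = begin
    (ι A - a ÷ M) * ι t          ≡⟨ distribute (ι A) a (1/ M) (ι t) ⟩
    ι A * ι t - a * (ι t ÷ M)    ≤⟨ ℚ.+-monoʳ-≤ (ι A * ι t) (ℚ.neg-antimono-≤ t/M≤a*t/M) ⟩
    ι A * ι t - ι t ÷ M          ≤⟨ ℚ.+-monoʳ-≤ (ι A * ι t) (ℚ.neg-antimono-≤ (ℚ.<⇒≤ N<t/M)) ⟩
    ι A * ι t - ι N              ≤⟨ ℚ.+-monoˡ-≤ (- ι N) At≤S+N′ ⟩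
    (ι S + ι N) - ι N            ≡⟨ cancel (ι S) (ι N) ⟩
    ι S                          ∎
    where
    open ℚ.≤-Reasoning
    open +-*-Solver
    distribute : ∀ x y z w → (x - y * z) * w ≡ x * w - y * (w * z)
    distribute = solve 4 (λ x y z w → (x :- y :* z) :* w := x :* w :- y :* (w :* z)) refl
    cancel : ∀ x y → (x + y) - y ≡ x
    cancel = solve 2 (λ x y → (x :+ y) :- y := x) refl
    At≤S+N′ : ι A * ι t ≤ ι S + ι N
    At≤S+N′ = subst₂ _≤_ (ι-homo-* A t) (ι-homo-+ S N) (ι-mono-≤ At≤S+N)
    1/M : ℚ
    1/M = 1/ M
    instance
      M>0 : ℚ.Positive M
      M>0 = ℚ.positive (ℚ.≤-<-trans (ℚ.≤-trans (ℚ.nonNegative⁻¹ 1ℚ) 1≤a) a<M)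
      t/M≥0 : ℚ.NonNegative (ι t ÷ M)
      t/M≥0 = ℚ.nonNeg*nonNeg⇒nonNeg (ι t) {{ℚ.normalize-nonNeg t 1}}
                                      1/M {{ℚ.pos⇒nonNeg 1/M {{ℚ.1/pos⇒pos M}}}}
    t/M≤a*t/M : ι t ÷ M ≤ a * (ι t ÷ M)
    t/M≤a*t/M = subst (_≤ a * (ι t ÷ M)) (ℚ.*-identityˡ (ι t ÷ M))
                      (ℚ.*-monoʳ-≤-nonNeg (ι t ÷ M) 1≤a)

open import Defs
open import Data.Nat as ℕ using (ℕ; zero; suc; _%_; s≤s)
import Data.Nat.Properties as ℕ
open import Data.Integer as ℤ using (+_)
open import Data.Rational as ℚ using (ℚ; _/_; _÷_; _<_; _≤_; _-_; _*_)
open import Data.Fin using (Fin; zero; suc)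
open import Data.Fin.Subset using (Subset; _∈_; ∣_∣)
open import Data.Bool using (Bool)
open import Relation.Binary.PropositionalEquality using (_≡_; sym; trans; cong; subst)
open OverIntegers using (size+distance-lower-bound)
open OverRationals using (/-mono-≤; slack-bound)

lemma8p7 : (k : ℕ) → 5 ℕ.≤ suc k → suc k % 2 ≡ 1 →
    (M : ℚ) → .{{_ : ℚ.NonZero M}} → (+ (suc k) / 2) < M →
    (ν : Fin k → Bool) → (t : ℕ) →
    (lam : Vecℤ (suc k)) → InRootLattice (suc k) lam →
    (+ norm1 (suc k) (λ j → lam j ℤ.- target k t ν j) / 1) < (+ t / 1) ÷ M →
    (m : Partition (suc k)) → InP (suc k) m lam →
    (I : Subset k) → ∣ I ∣ ≡ k ℕ.∸ 1 →
    (∀ i → i ∈ I → m zero (suc i) (ν i) ≡ 0) →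
    ((+ (suc k ℕ.+ 4) / 1) - ((+ (suc k) / 2) ÷ M)) * (+ t / 1) ℚ.≤ (+ size (suc k) m / 1)
lemma8p7 zero (s≤s ())
lemma8p7 (suc k) _ _ M n/2<M ν t lam _ dist<t/M m m∈P I ∣I∣≡k avoid =
  slack-bound (suc (suc k) ℕ.+ 4) t size-m dist (+ (suc (suc k)) / 2) M 1≤n/2 n/2<M dist<t/M
    (subst (λ c → c ℕ.* t ℕ.≤ size-m ℕ.+ dist) 6+∣I∣≡n+4 (size+distance-lower-bound I ν t lam m m∈P avoid))
  where
  size-m dist : ℕ
  size-m = size (suc (suc k)) m
  dist = norm1 (suc (suc k)) (λ j → lam j ℤ.- target (suc k) t ν j)
  1≤n/2 : ℚ.1ℚ ≤ + (suc (suc k)) / 2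
  1≤n/2 = /-mono-≤ {1} {suc (suc k)} {1} {2}
    (subst (2 ℕ.≤_) (sym (ℕ.*-identityʳ (suc (suc k)))) (s≤s (s≤s ℕ.z≤n)))
  6+∣I∣≡n+4 : 6 ℕ.+ ∣ I ∣ ≡ suc (suc k) ℕ.+ 4
  6+∣I∣≡n+4 = trans (cong (6 ℕ.+_) ∣I∣≡k) (cong (λ i → suc (suc i)) (ℕ.+-comm 4 k))
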